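{- Let $n\ge 2$ and $b\ne 0$ be fixed integers, and let $R_{n,b}(H)$ be the number of reducible monic polynomials $f(x)=x^n+a_{n-1}x^{n-1}+\cdots+a_1x+b\in\mathbb{Z}[x]$ (i.e. monic of degree $n$ with constant term $b$) of height at most $H$. Then, as $H\to\infty$, $R_{n,b}(H)\asymp H^{n-2}$.
   Context: The height of an integer polynomial is the maximum absolute value of its coefficients. $A\asymp B$ means $A\ll B\ll A$ with implied constants depending on $n$ and $b$. -}

module Defs where

open import Data.Nat using (ℕ; zero; suc; _+_; _∸_; _^_; _≤_; _⊔_)
open import Data.Integer as ℤ using (ℤ; +_; ∣_∣)
open import Data.List using (List; []; _∷_; map; _++_; [_]; foldr)
open import Data.Vec using (Vec; toList)
open import Data.Product using (Σ; ∃; _×_)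
open import Relation.Binary.PropositionalEquality using (_≡_)

-- Integer polynomials as coefficient lists, lowest degree first.

polyAdd : List ℤ → List ℤ → List ℤ
polyAdd []       q        = q
polyAdd (a ∷ p)  []       = a ∷ p
polyAdd (a ∷ p)  (c ∷ q)  = (a ℤ.+ c) ∷ polyAdd p q

polyMul : List ℤ → List ℤ → List ℤ
polyMul []      q = []
polyMul (a ∷ p) q = polyAdd (map (a ℤ.*_) q) (+ 0 ∷ polyMul p q)

monic : ∀ {d} → Vec ℤ d → List ℤ
monic c = toList c ++ [ + 1 ]

height : List ℤ → ℕ
height = foldr (λ a h → ∣ a ∣ ⊔ h) 0

-- The polynomial x^n + a_{n-1} x^{n-1} + … + a_1 x + b, where the vector
-- a holds a_1,…,a_{n-1} (n ≥ 1).
fam : ∀ n → ℤ → Vec ℤ (n ∸ 1) → List ℤ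
fam n b a = b ∷ monic a

-- A monic integer polynomial p (coefficient list) of degree n is reducible
-- iff it is a product of two monic integer polynomials of positive degree
-- (by Gauss's lemma this is reducibility over ℤ, equivalently over ℚ).
ReducibleMonic : ℕ → List ℤ → Set
ReducibleMonic n p =
  Σ ℕ λ d → Σ ℕ λ e → (1 ≤ d) × (1 ≤ e) × (d + e ≡ n) ×
  Σ (Vec ℤ d) λ g → Σ (Vec ℤ e) λ h → polyMul (monic g) (monic h) ≡ p

{-# OPTIONS --safe #-}

-- If x^n + ⋯ + b = g h with g, h monic, then g(0) h(0) = b ≠ 0, so at the points
-- x = |b| + 1 + j the value h(x) ≡ h(0) (mod x) cannot vanish and |g(x)| ≤ |f(x)| = O(H).
-- The values of g at deg g + 1 consecutive integers bound its coefficients (repeated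
-- synthetic division), so g and h have constant terms of absolute value ≤ |b| and all other
-- non-leading coefficients O(H). As deg g + deg h = n, there are O(H^(n-2)) such pairs (g, h).
-- Conversely, the polynomials (1 + x)(b + c₁x + ⋯ + c_{n-2}x^{n-2} + x^{n-1}) with
-- 0 ≤ cᵢ ≤ H / (4 + 2|b|) are distinct, reducible and of height at most H.

module Submission where

open import Defs
open import Data.Integer as ℤ using (ℤ; +_; -[1+_]; ∣_∣; 0ℤ)
open import Data.Integer.Tactic.RingSolver using (solve-∀)
open import Data.List
  using (List; []; _∷_; map; _++_; [_]; length; upTo; cartesianProductWith; filter; deduplicate)
open import Data.List.Membership.Propositional using (_∈_)
open import Data.List.Membership.Propositional.Properties
open import Data.List.Properties
  using (length-++; length-map; length-upTo; length-removeAt′; map-cong; map-id; ++-cancelʳ)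
open import Data.List.Relation.Binary.Subset.Propositional using (_⊆_)
open import Data.List.Relation.Unary.All as All using (All; []; _∷_)
open import Data.List.Relation.Unary.All.Properties using (++⁺)
open import Data.List.Relation.Unary.AllPairs using ([]; _∷_)
open import Data.List.Relation.Unary.Any using (here; there; _─_)
open import Data.List.Relation.Unary.Unique.Propositional using (Unique)
open import Data.Nat
  using (ℕ; zero; suc; _≤_; _<_; _*_; _+_; _∸_; _^_; z≤n; s≤s; _≤′_; ≤′-refl; ≤′-step; _/_; NonZero; ≢-nonZero)
open import Data.Nat.DivMod using (_%_; m/n*n≤m; m≥n⇒m/n>0; m≡m%n+[m/n]*n; m%n<n)
open import Data.Nat.Properties
open import Data.Product using (Σ; _×_; _,_; proj₁; proj₂)
open import Data.Sum using (inj₁; inj₂)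
open import Data.Vec using (Vec; []; _∷_; toList; _∷ʳ_; head)
open import Function using (_∘_)
open import Function.Bundles using (_⇔_; mk⇔; Equivalence)
open import Relation.Binary.Definitions using (DecidableEquality)
open import Relation.Binary.PropositionalEquality hiding ([_])
open import Relation.Nullary using (¬_; contradiction)
open import Relation.Nullary.Decidable using (_×-dec_)
open import Relation.Unary using (Decidable)
import Data.Integer.Properties as ℤP
import Data.List.Properties as List
import Data.List.Relation.Unary.Unique.Propositional.Properties as Unique
import Data.Nat.Tactic.RingSolver as ℕ-Solver
import Data.Vec.Properties as Vec
open import Algebra.Properties.AbelianGroup ℤP.+-0-abelianGroup using (∙-cancelʳ; inverseˡ-unique)
open import Data.List.Membership.DecPropositional (List.≡-dec ℤ._≟_) using (_∈?_)

private variable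
  A : Set

eval : List ℤ → ℤ → ℤ
eval []       x = 0ℤ
eval (c ∷ cs) x = c ℤ.+ x ℤ.* eval cs x

eval-polyAdd : ∀ p q x → eval (polyAdd p q) x ≡ eval p x ℤ.+ eval q x
eval-polyAdd []      q       x = sym (ℤP.+-identityˡ _)
eval-polyAdd (a ∷ p) []      x = sym (ℤP.+-identityʳ _)
eval-polyAdd (a ∷ p) (c ∷ q) x rewrite eval-polyAdd p q x = ring a c x (eval p x) (eval q x)
  where
  ring : ∀ a c x P Q → a ℤ.+ c ℤ.+ x ℤ.* (P ℤ.+ Q) ≡ a ℤ.+ x ℤ.* P ℤ.+ (c ℤ.+ x ℤ.* Q)
  ring = solve-∀

eval-map-* : ∀ a q x → eval (map (a ℤ.*_) q) x ≡ a ℤ.* eval q x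
eval-map-* a []      x = sym (ℤP.*-zeroʳ a)
eval-map-* a (c ∷ q) x rewrite eval-map-* a q x = ring a c x (eval q x)
  where
  ring : ∀ a c x Q → a ℤ.* c ℤ.+ x ℤ.* (a ℤ.* Q) ≡ a ℤ.* (c ℤ.+ x ℤ.* Q)
  ring = solve-∀

eval-polyMul : ∀ p q x → eval (polyMul p q) x ≡ eval p x ℤ.* eval q x
eval-polyMul []      q x = sym (ℤP.*-zeroˡ (eval q x))
eval-polyMul (a ∷ p) q x
  rewrite eval-polyAdd (map (a ℤ.*_) q) (0ℤ ∷ polyMul p q) x
        | eval-map-* a q x | eval-polyMul p q x = ring a x (eval p x) (eval q x)
  where
  ring : ∀ a x P Q → a ℤ.* Q ℤ.+ (0ℤ ℤ.+ x ℤ.* (P ℤ.* Q)) ≡ (a ℤ.+ x ℤ.* P) ℤ.* Q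
  ring = solve-∀

norm₁ : List ℤ → ℕ
norm₁ []       = 0
norm₁ (c ∷ cs) = ∣ c ∣ + norm₁ cs

∣eval∣≤norm₁*X^length : ∀ p {k X} .{{_ : NonZero X}} → k ≤ X →
                        ∣ eval p (+ k) ∣ ≤ norm₁ p * X ^ length p
∣eval∣≤norm₁*X^length []       k≤X = z≤n
∣eval∣≤norm₁*X^length (c ∷ cs) {k} {X} k≤X = begin
  ∣ c ℤ.+ + k ℤ.* eval cs (+ k) ∣      ≤⟨ ℤP.∣i+j∣≤∣i∣+∣j∣ c _ ⟩
  ∣ c ∣ + ∣ + k ℤ.* eval cs (+ k) ∣    ≡⟨ cong (_+_ ∣ c ∣) (ℤP.∣i*j∣≡∣i∣*∣j∣ (+ k) _) ⟩
  ∣ c ∣ + k * ∣ eval cs (+ k) ∣        ≤⟨ +-mono-≤ (m≤m*n ∣ c ∣ (X ^ suc l) {{m^n≢0 X (suc l)}})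
                                                   (*-mono-≤ k≤X (∣eval∣≤norm₁*X^length cs k≤X)) ⟩
  ∣ c ∣ * X ^ suc l + X * (norm₁ cs * X ^ l) ≡⟨ ring ∣ c ∣ X (norm₁ cs) (X ^ l) ⟩
  (∣ c ∣ + norm₁ cs) * X ^ suc l       ∎
  where
  open ≤-Reasoning
  l = length cs
  ring : ∀ a X N P → a * (X * P) + X * (N * P) ≡ (a + N) * (X * P)
  ring = ℕ-Solver.solve-∀

norm₁≤length*height : ∀ p → norm₁ p ≤ length p * height p
norm₁≤length*height []       = z≤n
norm₁≤length*height (c ∷ cs) = +-mono-≤ (m≤m⊔n ∣ c ∣ (height cs))
  (≤-trans (norm₁≤length*height cs) (*-monoʳ-≤ (length cs) (m≤n⊔m ∣ c ∣ (height cs))))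

∈⇒∣∣≤height : ∀ {x p} → x ∈ p → ∣ x ∣ ≤ height p
∈⇒∣∣≤height {p = y ∷ p} (here refl) = m≤m⊔n ∣ y ∣ (height p)
∈⇒∣∣≤height {p = y ∷ p} (there x∈p) = ≤-trans (∈⇒∣∣≤height x∈p) (m≤n⊔m ∣ y ∣ (height p))

∈⇒∣∣≤norm₁ : ∀ {x p} → x ∈ p → ∣ x ∣ ≤ norm₁ p
∈⇒∣∣≤norm₁ {p = y ∷ p} (here refl) = m≤m+n ∣ y ∣ (norm₁ p)
∈⇒∣∣≤norm₁ {p = y ∷ p} (there x∈p) = ≤-trans (∈⇒∣∣≤norm₁ x∈p) (m≤n+m (norm₁ p) ∣ y ∣)

All⇒height≤ : ∀ {Y p} → All (λ x → ∣ x ∣ ≤ Y) p → height p ≤ Y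
All⇒height≤ []           = z≤n
All⇒height≤ (x≤Y ∷ p≤Y) = ⊔-lub x≤Y (All⇒height≤ p≤Y)

height-polyAdd : ∀ p q → height (polyAdd p q) ≤ height p + height q
height-polyAdd []      q       = ≤-refl
height-polyAdd (a ∷ p) []      = m≤m+n _ 0
height-polyAdd (a ∷ p) (c ∷ q) = ⊔-lub
  (≤-trans (ℤP.∣i+j∣≤∣i∣+∣j∣ a c) (+-mono-≤ (m≤m⊔n ∣ a ∣ (height p)) (m≤m⊔n ∣ c ∣ (height q))))
  (≤-trans (height-polyAdd p q) (+-mono-≤ (m≤n⊔m ∣ a ∣ (height p)) (m≤n⊔m ∣ c ∣ (height q))))

height-map-* : ∀ a q → height (map (a ℤ.*_) q) ≤ ∣ a ∣ * height q
height-map-* a []      = z≤n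
height-map-* a (c ∷ q) = ⊔-lub
  (≤-trans (≤-reflexive (ℤP.∣i*j∣≡∣i∣*∣j∣ a c)) (*-monoʳ-≤ ∣ a ∣ (m≤m⊔n ∣ c ∣ (height q))))
  (≤-trans (height-map-* a q) (*-monoʳ-≤ ∣ a ∣ (m≤n⊔m ∣ c ∣ (height q))))

height-polyMul : ∀ p q → height (polyMul p q) ≤ norm₁ p * height q
height-polyMul []      q = z≤n
height-polyMul (a ∷ p) q = begin
  height (polyAdd (map (a ℤ.*_) q) (0ℤ ∷ polyMul p q)) ≤⟨ height-polyAdd (map (a ℤ.*_) q) _ ⟩
  height (map (a ℤ.*_) q) + height (polyMul p q)      ≤⟨ +-mono-≤ (height-map-* a q) (height-polyMul p q) ⟩
  ∣ a ∣ * height q + norm₁ p * height q               ≡⟨ *-distribʳ-+ (height q) ∣ a ∣ (norm₁ p) ⟨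
  (∣ a ∣ + norm₁ p) * height q                        ∎
  where open ≤-Reasoning

quotient : ∀ {m} → ℤ → Vec ℤ (suc m) → Vec ℤ m
quotient β (c ∷ [])     = []
quotient β (c ∷ d ∷ cs) = eval (toList (d ∷ cs)) β ∷ quotient β (d ∷ cs)

eval-quotient : ∀ {m} β (p : Vec ℤ (suc m)) x →
  eval (toList p) x ≡ (x ℤ.- β) ℤ.* eval (toList (quotient β p)) x ℤ.+ eval (toList p) β
eval-quotient β (c ∷ [])     x = ring c x β
  where
  ring : ∀ c x β → c ℤ.+ x ℤ.* 0ℤ ≡ (x ℤ.- β) ℤ.* 0ℤ ℤ.+ (c ℤ.+ β ℤ.* 0ℤ)
  ring = solve-∀
eval-quotient β (c ∷ d ∷ cs) x rewrite eval-quotient β (d ∷ cs) x =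
  ring c x β (eval (toList (quotient β (d ∷ cs))) x) (eval (toList (d ∷ cs)) β)
  where
  ring : ∀ c x β Q r → c ℤ.+ x ℤ.* ((x ℤ.- β) ℤ.* Q ℤ.+ r) ≡
                       (x ℤ.- β) ℤ.* (r ℤ.+ x ℤ.* Q) ℤ.+ (c ℤ.+ β ℤ.* r)
  ring = solve-∀

norm₁-quotient : ∀ {m} B (p : Vec ℤ (suc m)) →
  norm₁ (toList p) ≤ suc B * norm₁ (toList (quotient (+ B) p)) + ∣ eval (toList p) (+ B) ∣
norm₁-quotient B (c ∷ [])     =
  ≤-trans (≤-reflexive (trans (+-identityʳ ∣ c ∣) (cong ∣_∣ (ring c (+ B))))) (m≤n+m _ (suc B * 0))
  where
  ring : ∀ c β → c ≡ c ℤ.+ β ℤ.* 0ℤ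
  ring = solve-∀
norm₁-quotient B (c ∷ d ∷ cs) = begin
  ∣ c ∣ + norm₁ (toList (d ∷ cs))           ≤⟨ +-mono-≤ ∣c∣≤ (norm₁-quotient B (d ∷ cs)) ⟩
  (∣ R ∣ + B * ∣ r ∣) + (suc B * norm₁ (toList q) + ∣ r ∣) ≡⟨ ring (∣ R ∣) B (∣ r ∣) (norm₁ (toList q)) ⟩
  suc B * (∣ r ∣ + norm₁ (toList q)) + ∣ R ∣ ∎
  where
  open ≤-Reasoning
  r = eval (toList (d ∷ cs)) (+ B)
  q = quotient (+ B) (d ∷ cs)
  R = c ℤ.+ + B ℤ.* r
  add-sub : ∀ c y → c ≡ (c ℤ.+ y) ℤ.- y
  add-sub = solve-∀
  ∣c∣≤ : ∣ c ∣ ≤ ∣ R ∣ + B * ∣ r ∣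
  ∣c∣≤ = begin
    ∣ c ∣                 ≡⟨ cong ∣_∣ (add-sub c (+ B ℤ.* r)) ⟩
    ∣ R ℤ.- + B ℤ.* r ∣   ≤⟨ ℤP.∣i-j∣≤∣i∣+∣j∣ R _ ⟩
    ∣ R ∣ + ∣ + B ℤ.* r ∣ ≡⟨ cong (_+_ ∣ R ∣) (ℤP.∣i*j∣≡∣i∣*∣j∣ (+ B) r) ⟩
    ∣ R ∣ + B * ∣ r ∣     ∎
  ring : ∀ a B r q → (a + B * r) + (suc B * q + r) ≡ suc B * (r + q) + a
  ring = ℕ-Solver.solve-∀

eval-quotient-at : ∀ {m} B j (p : Vec ℤ (suc m)) →
  eval (toList p) (+ (B + j)) ≡
  + j ℤ.* eval (toList (quotient (+ B) p)) (+ (B + j)) ℤ.+ eval (toList p) (+ B)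
eval-quotient-at B j p = trans (eval-quotient (+ B) p (+ (B + j)))
  (cong (λ d → d ℤ.* eval (toList (quotient (+ B) p)) (+ (B + j)) ℤ.+ eval (toList p) (+ B))
        (trans (cong (ℤ._- + B) (ℤP.pos-+ B j)) (add-sub (+ B) (+ j))))
  where
  add-sub : ∀ a b → a ℤ.+ b ℤ.- a ≡ b
  add-sub = solve-∀

∣eval-quotient∣≤ : ∀ {m} B j M (p : Vec ℤ (suc m)) →
  ∣ eval (toList p) (+ B) ∣ ≤ M → ∣ eval (toList p) (+ (B + suc j)) ∣ ≤ M →
  ∣ eval (toList (quotient (+ B) p)) (+ (B + suc j)) ∣ ≤ M + M
∣eval-quotient∣≤ B j M p r≤M pₓ≤M = begin
  ∣ E ∣                    ≤⟨ m≤n*m ∣ E ∣ (suc j) ⟩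
  suc j * ∣ E ∣            ≡⟨ ℤP.∣i*j∣≡∣i∣*∣j∣ (+ suc j) E ⟨
  ∣ + suc j ℤ.* E ∣        ≡⟨ cong ∣_∣ (trans (sub-add (+ suc j ℤ.* E) r) (cong (ℤ._- r) (sym pₓ≡))) ⟩
  ∣ pₓ ℤ.- r ∣             ≤⟨ ℤP.∣i-j∣≤∣i∣+∣j∣ pₓ r ⟩
  ∣ pₓ ∣ + ∣ r ∣           ≤⟨ +-mono-≤ pₓ≤M r≤M ⟩
  M + M                    ∎
  where
  open ≤-Reasoning
  E = eval (toList (quotient (+ B) p)) (+ (B + suc j))
  pₓ = eval (toList p) (+ (B + suc j))
  r = eval (toList p) (+ B)
  pₓ≡ : pₓ ≡ + suc j ℤ.* E ℤ.+ r
  pₓ≡ = eval-quotient-at B (suc j) p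
  sub-add : ∀ a b → a ≡ a ℤ.+ b ℤ.- b
  sub-add = solve-∀

-- With q = (p − p(B)) / (x − B) we have (j + 1) q(B + 1 + j) = p(B + 1 + j) − p(B), so bounds M
-- on p at B, …, B + m give bounds 2M on q at B + 1, …, B + m, and p = (x − B) q + p(B).
interpolationConst : ℕ → ℕ → ℕ
interpolationConst zero    B = 1
interpolationConst (suc m) B = suc B * (2 * interpolationConst m (suc B)) + 1

norm₁≤interpolationConst*M : ∀ m B M (p : Vec ℤ (suc m)) →
  (∀ j → j ≤ m → ∣ eval (toList p) (+ (B + j)) ∣ ≤ M) →
  norm₁ (toList p) ≤ interpolationConst m B * M
norm₁≤interpolationConst*M zero B M (c ∷ []) p≤M = begin
  ∣ c ∣ + 0                  ≡⟨ trans (+-identityʳ ∣ c ∣) (cong ∣_∣ (ring c (+ (B + 0)))) ⟩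
  ∣ c ℤ.+ + (B + 0) ℤ.* 0ℤ ∣ ≤⟨ p≤M 0 z≤n ⟩
  M                          ≡⟨ +-identityʳ M ⟨
  1 * M                      ∎
  where
  open ≤-Reasoning
  ring : ∀ c x → c ≡ c ℤ.+ x ℤ.* 0ℤ
  ring = solve-∀
norm₁≤interpolationConst*M (suc m) B M p p≤M = begin
  norm₁ (toList p)                                     ≤⟨ norm₁-quotient B p ⟩
  suc B * norm₁ (toList q) + ∣ r ∣                     ≤⟨ +-mono-≤ (*-monoʳ-≤ (suc B) q-norm) r≤M ⟩
  suc B * (interpolationConst m (suc B) * (M + M)) + M ≡⟨ ring (suc B) (interpolationConst m (suc B)) M ⟩
  interpolationConst (suc m) B * M                     ∎
  where
  open ≤-Reasoning
  q = quotient (+ B) p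
  r = eval (toList p) (+ B)
  r≤M : ∣ r ∣ ≤ M
  r≤M = subst (λ x → ∣ eval (toList p) (+ x) ∣ ≤ M) (+-identityʳ B) (p≤M 0 z≤n)
  q≤M+M : ∀ j → j ≤ m → ∣ eval (toList q) (+ (suc B + j)) ∣ ≤ M + M
  q≤M+M j j≤m = subst (λ x → ∣ eval (toList q) (+ x) ∣ ≤ M + M) (+-suc B j)
                      (∣eval-quotient∣≤ B j M p r≤M (p≤M (suc j) (s≤s j≤m)))
  q-norm : norm₁ (toList q) ≤ interpolationConst m (suc B) * (M + M)
  q-norm = norm₁≤interpolationConst*M m (suc B) (M + M) q q≤M+M
  ring : ∀ s k M → s * (k * (M + M)) + M ≡ (s * (2 * k) + 1) * M
  ring = ℕ-Solver.solve-∀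

interpolationConst-step : ∀ m B → interpolationConst m B ≤ interpolationConst (suc m) B
interpolationConst-step zero    B = m≤n+m 1 (suc B * (2 * 1))
interpolationConst-step (suc m) B =
  +-monoˡ-≤ 1 (*-monoʳ-≤ (suc B) (*-monoʳ-≤ 2 (interpolationConst-step m (suc B))))

interpolationConst-mono : ∀ {m m′} B → m ≤ m′ → interpolationConst m B ≤ interpolationConst m′ B
interpolationConst-mono B m≤m′ = go (≤⇒≤′ m≤m′)
  where
  go : ∀ {m m′} → m ≤′ m′ → interpolationConst m B ≤ interpolationConst m′ B
  go ≤′-refl                     = ≤-refl
  go {m′ = suc m′} (≤′-step m≤m′) = ≤-trans (go m≤m′) (interpolationConst-step m′ B)

∣c∣<k⇒c+k*t≢0 : ∀ c t k → c ≢ 0ℤ → ∣ c ∣ < k → c ℤ.+ + k ℤ.* t ≢ 0ℤ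
∣c∣<k⇒c+k*t≢0 c t k c≢0 ∣c∣<k c+kt≡0 = c≢0 (ℤP.∣i∣≡0⇒i≡0 ∣c∣≡0)
  where
  open ≡-Reasoning
  ∣c∣≡k*∣t∣ : ∣ c ∣ ≡ k * ∣ t ∣
  ∣c∣≡k*∣t∣ = begin
    ∣ c ∣               ≡⟨ cong ∣_∣ (inverseˡ-unique c (+ k ℤ.* t) c+kt≡0) ⟩
    ∣ ℤ.- (+ k ℤ.* t) ∣ ≡⟨ ℤP.∣-i∣≡∣i∣ (+ k ℤ.* t) ⟩
    ∣ + k ℤ.* t ∣       ≡⟨ ℤP.∣i*j∣≡∣i∣*∣j∣ (+ k) t ⟩
    k * ∣ t ∣           ∎
  ∣t∣≡0 : ∣ t ∣ ≡ 0
  ∣t∣≡0 = n<1⇒n≡0 (*-cancelˡ-< k ∣ t ∣ 1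
    (subst₂ _<_ ∣c∣≡k*∣t∣ (sym (*-identityʳ k)) ∣c∣<k))
  ∣c∣≡0 : ∣ c ∣ ≡ 0
  ∣c∣≡0 = begin
    ∣ c ∣     ≡⟨ ∣c∣≡k*∣t∣ ⟩
    k * ∣ t ∣ ≡⟨ cong (k *_) ∣t∣≡0 ⟩
    k * 0     ≡⟨ *-zeroʳ k ⟩
    0         ∎

∣i∣≤∣i*j∣ : ∀ i j → j ≢ 0ℤ → ∣ i ∣ ≤ ∣ i ℤ.* j ∣
∣i∣≤∣i*j∣ i j j≢0 = ≤-trans (m≤m*n ∣ i ∣ ∣ j ∣ {{≢-nonZero (j≢0 ∘ ℤP.∣i∣≡0⇒i≡0)}})
                            (≤-reflexive (sym (ℤP.∣i*j∣≡∣i∣*∣j∣ i j)))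

norm₁-monicFactor≤ : ∀ {d e} B M f (g : Vec ℤ d) (h : Vec ℤ e) →
  (∀ x → eval f x ≡ eval (monic g) x ℤ.* eval (monic h) x) →
  (∀ j → j ≤ d → eval (monic h) (+ (B + j)) ≢ 0ℤ) →
  (∀ j → j ≤ d → ∣ eval f (+ (B + j)) ∣ ≤ M) →
  norm₁ (monic g) ≤ interpolationConst d B * M
norm₁-monicFactor≤ {d} B M f g h f≡gh h≢0 f≤M =
  subst (λ p → norm₁ p ≤ interpolationConst d B * M) (Vec.toList-∷ʳ (+ 1) g)
        (norm₁≤interpolationConst*M d B M (g ∷ʳ + 1) g≤M)
  where
  g≤M : ∀ j → j ≤ d → ∣ eval (toList (g ∷ʳ + 1)) (+ (B + j)) ∣ ≤ M
  g≤M j j≤d = begin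
    ∣ eval (toList (g ∷ʳ + 1)) x ∣            ≡⟨ cong (λ p → ∣ eval p x ∣) (Vec.toList-∷ʳ (+ 1) g) ⟩
    ∣ eval (monic g) x ∣                      ≤⟨ ∣i∣≤∣i*j∣ (eval (monic g) x) _ (h≢0 j j≤d) ⟩
    ∣ eval (monic g) x ℤ.* eval (monic h) x ∣ ≡⟨ cong ∣_∣ (f≡gh x) ⟨
    ∣ eval f x ∣                              ≤⟨ f≤M j j≤d ⟩
    M                                         ∎
    where
    open ≤-Reasoning
    x = + (B + j)

range : ℕ → List ℤ
range T = map +_ (upTo (suc T)) ++ map -[1+_] (upTo T)

length-range : ∀ T → length (range T) ≡ suc T + T
length-range T = trans (length-++ (map +_ (upTo (suc T))))
  (cong₂ _+_ (trans (length-map +_ (upTo (suc T))) (length-upTo (suc T)))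
             (trans (length-map -[1+_] (upTo T)) (length-upTo T)))

∣∣≤⇒∈range : ∀ {T} z → ∣ z ∣ ≤ T → z ∈ range T
∣∣≤⇒∈range (+ i)        i≤T = ∈-++⁺ˡ (∈-map⁺ +_ (∈-upTo⁺ (s≤s i≤T)))
∣∣≤⇒∈range {T} -[1+ i ] i<T = ∈-++⁺ʳ (map +_ (upTo (suc T))) (∈-map⁺ -[1+_] (∈-upTo⁺ i<T))

length-cartesianProductWith : ∀ {A B C : Set} (f : A → B → C) xs ys →
  length (cartesianProductWith f xs ys) ≡ length xs * length ys
length-cartesianProductWith f []       ys = refl
length-cartesianProductWith f (x ∷ xs) ys = trans (length-++ (map (f x) ys))
  (cong₂ _+_ (length-map (f x) ys) (length-cartesianProductWith f xs ys))

cube : (d : ℕ) → List A → List (Vec A d)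
cube zero    R = [] ∷ []
cube (suc d) R = cartesianProductWith _∷_ R (cube d R)

length-cube : ∀ d (R : List A) → length (cube d R) ≡ length R ^ d
length-cube zero    R = refl
length-cube (suc d) R =
  trans (length-cartesianProductWith _∷_ R (cube d R)) (cong (length R *_) (length-cube d R))

∈-cube⁺ : ∀ {d} {R : List A} (v : Vec A d) → All (_∈ R) (toList v) → v ∈ cube d R
∈-cube⁺ []      []           = here refl
∈-cube⁺ (x ∷ v) (x∈R ∷ v∈R) = ∈-cartesianProductWith⁺ _∷_ x∈R (∈-cube⁺ v v∈R)

∈-cube⁻ : ∀ {d} {R : List A} (v : Vec A d) → v ∈ cube d R → All (_∈ R) (toList v)
∈-cube⁻ []                  _     = []
∈-cube⁻ {d = suc d} {R} (x ∷ v) x∷v∈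
  with _ , _ , x∈R , v∈ , refl ← ∈-cartesianProductWith⁻ _∷_ R (cube d R) x∷v∈
  = x∈R ∷ ∈-cube⁻ v v∈

cube⁺ : ∀ d {R : List A} → Unique R → Unique (cube d R)
cube⁺ zero    _   = [] ∷ []
cube⁺ (suc d) R! = Unique.cartesianProductWith⁺ _∷_ Vec.∷-injective R! (cube⁺ d R!)

∈-─⁺ : ∀ {x y} {ys : List A} (x∈ys : x ∈ ys) → y ∈ ys → y ≢ x → y ∈ (ys ─ x∈ys)
∈-─⁺ (here refl)  (here refl)  y≢x = contradiction refl y≢x
∈-─⁺ (there _)    (here refl)  y≢x = here refl
∈-─⁺ (here _)     (there y∈ys) y≢x = y∈ys
∈-─⁺ (there x∈ys) (there y∈ys) y≢x = there (∈-─⁺ x∈ys y∈ys y≢x)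

Unique∧⊆⇒length≤ : ∀ {xs ys : List A} → Unique xs → xs ⊆ ys → length xs ≤ length ys
Unique∧⊆⇒length≤ {xs = []}     _              _     = z≤n
Unique∧⊆⇒length≤ {xs = x ∷ xs} {ys} (x∉xs ∷ xs!) xs⊆ys = begin
  suc (length xs)             ≤⟨ s≤s (Unique∧⊆⇒length≤ xs! xs⊆ys─x) ⟩
  suc (length (ys ─ x∈ys))    ≡⟨ length-removeAt′ ys _ ⟨
  length ys                   ∎
  where
  open ≤-Reasoning
  x∈ys = xs⊆ys (here refl)
  xs⊆ys─x : xs ⊆ (ys ─ x∈ys)
  xs⊆ys─x y∈xs = ∈-─⁺ x∈ys (xs⊆ys (there y∈xs)) (λ y≡x → All.lookup x∉xs y∈xs (sym y≡x))

timesOnePlusX : ∀ {m} → ℤ → Vec ℤ m → Vec ℤ (suc m)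
timesOnePlusX p []       = + 1 ℤ.+ p ∷ []
timesOnePlusX p (c ∷ cs) = c ℤ.+ p ∷ timesOnePlusX c cs

timesOnePlusX-injective : ∀ {m} p {u v : Vec ℤ m} → timesOnePlusX p u ≡ timesOnePlusX p v → u ≡ v
timesOnePlusX-injective p {[]}    {[]}    _  = refl
timesOnePlusX-injective p {x ∷ u} {y ∷ v} eq with ∙-cancelʳ p x y (Vec.∷-injectiveˡ eq)
... | refl = cong (x ∷_) (timesOnePlusX-injective x (Vec.∷-injectiveʳ eq))

polyAdd-identityʳ : ∀ p → polyAdd p [] ≡ p
polyAdd-identityʳ []      = refl
polyAdd-identityʳ (a ∷ p) = refl

polyAdd-shift : ∀ {m} p (c : Vec ℤ m) → polyAdd (monic c) (p ∷ monic c) ≡ monic (timesOnePlusX p c)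
polyAdd-shift p []       = refl
polyAdd-shift p (c ∷ cs) = cong (c ℤ.+ p ∷_) (polyAdd-shift c cs)

polyMul-onePlusX : ∀ {m} p (c : Vec ℤ m) →
  polyMul (+ 1 ∷ + 1 ∷ []) (p ∷ monic c) ≡ p ∷ monic (timesOnePlusX p c)
polyMul-onePlusX p c = begin
  polyAdd (map (+ 1 ℤ.*_) Q) (0ℤ ∷ polyAdd (map (+ 1 ℤ.*_) Q) (0ℤ ∷ []))
    ≡⟨ cong (λ Q′ → polyAdd Q′ (0ℤ ∷ polyAdd Q′ (0ℤ ∷ []))) map-1*-Q ⟩
  p ℤ.+ 0ℤ ∷ polyAdd (monic c) (p ℤ.+ 0ℤ ∷ polyAdd (monic c) [])
    ≡⟨ cong₂ (λ p′ q → p′ ∷ polyAdd (monic c) (p′ ∷ q)) (ℤP.+-identityʳ p) (polyAdd-identityʳ (monic c)) ⟩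
  p ∷ polyAdd (monic c) (p ∷ monic c)
    ≡⟨ cong (p ∷_) (polyAdd-shift p c) ⟩
  p ∷ monic (timesOnePlusX p c) ∎
  where
  open ≡-Reasoning
  Q = p ∷ monic c
  map-1*-Q : map (+ 1 ℤ.*_) Q ≡ Q
  map-1*-Q = trans (map-cong ℤP.*-identityˡ Q) (map-id Q)

^-distribʳ-* : ∀ m n k → (m * n) ^ k ≡ m ^ k * n ^ k
^-distribʳ-* m n zero    = refl
^-distribʳ-* m n (suc k) = trans (cong (m * n *_) (^-distribʳ-* m n k)) (ring m n (m ^ k) (n ^ k))
  where
  ring : ∀ m n x y → m * n * (x * y) ≡ m * x * (n * y)
  ring = ℕ-Solver.solve-∀

module Counting (n′ : ℕ) (b : ℤ) (b≢0 : b ≢ 0ℤ) where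

  n c B : ℕ
  n = suc (suc n′)
  c = ∣ b ∣
  B = suc c

  length-fam : ∀ a → length (fam n b a) ≡ suc n
  length-fam a = cong suc (begin
    length (toList a ++ [ + 1 ])    ≡⟨ length-++ (toList a) ⟩
    length (toList a) + 1           ≡⟨ cong (_+ 1) (Vec.length-toList a) ⟩
    suc n′ + 1                      ≡⟨ +-comm (suc n′) 1 ⟩
    suc (suc n′)                    ∎)
    where open ≡-Reasoning

  fam-injective : ∀ {u v} → fam n b u ≡ fam n b v → u ≡ v
  fam-injective {u} {v} eq = trans (sym (Vec.cast-is-id refl u))
    (Vec.toList-injective refl u v (++-cancelʳ [ + 1 ] (toList u) (toList v) (List.∷-injectiveʳ eq)))

  fam-value-bound : ∀ {a H j} → height (fam n b a) ≤ H → j ≤ n →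
                    ∣ eval (fam n b a) (+ (B + j)) ∣ ≤ suc n * H * (B + n) ^ suc n
  fam-value-bound {a} {H} {j} f≤H j≤n = begin
    ∣ eval f (+ (B + j)) ∣       ≤⟨ ∣eval∣≤norm₁*X^length f (+-monoʳ-≤ B j≤n) ⟩
    norm₁ f * (B + n) ^ length f ≡⟨ cong (λ l → norm₁ f * (B + n) ^ l) (length-fam a) ⟩
    norm₁ f * (B + n) ^ suc n    ≤⟨ *-monoˡ-≤ _ (≤-trans (norm₁≤length*height f)
                                                        (*-mono-≤ (≤-reflexive (length-fam a)) f≤H)) ⟩
    suc n * H * (B + n) ^ suc n  ∎
    where
    open ≤-Reasoning
    f = fam n b a

  coefficientBound : ℕ
  coefficientBound = interpolationConst n B * (suc n * (B + n) ^ suc n)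

  box : (d′ : ℕ) → ℕ → List (Vec ℤ (suc d′))
  box d′ T = cartesianProductWith _∷_ (range c) (cube d′ (range T))

  length-box : ∀ d′ T → length (box d′ T) ≡ (suc c + c) * (suc T + T) ^ d′
  length-box d′ T = trans (length-cartesianProductWith _∷_ (range c) (cube d′ (range T)))
    (cong₂ _*_ (length-range c) (trans (length-cube d′ (range T)) (cong (_^ d′) (length-range T))))

  factor∈box : ∀ {d′ e′ a H} (g : Vec ℤ (suc d′)) (h : Vec ℤ (suc e′)) → d′ ≤ n′ →
    (∀ x → eval (fam n b a) x ≡ eval (monic g) x ℤ.* eval (monic h) x) →
    head g ℤ.* head h ≡ b → height (fam n b a) ≤ H →
    g ∈ box d′ (coefficientBound * H)
  factor∈box {d′} {a = a} {H} (g₀ ∷ g′) (h₀ ∷ h′) d′≤n′ f≡gh g₀h₀≡b f≤H =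
    ∈-cartesianProductWith⁺ _∷_ (∣∣≤⇒∈range {c} g₀ ∣g₀∣≤c) (∈-cube⁺ g′ (All.tabulate g′-bounded))
    where
    open ≤-Reasoning
    M = suc n * H * (B + n) ^ suc n
    g₀≢0 : g₀ ≢ 0ℤ
    g₀≢0 g₀≡0 = b≢0 (trans (sym g₀h₀≡b) (trans (cong (ℤ._* h₀) g₀≡0) (ℤP.*-zeroˡ h₀)))
    h₀≢0 : h₀ ≢ 0ℤ
    h₀≢0 h₀≡0 = b≢0 (trans (sym g₀h₀≡b) (trans (cong (g₀ ℤ.*_) h₀≡0) (ℤP.*-zeroʳ g₀)))
    ∣g₀∣≤c : ∣ g₀ ∣ ≤ c
    ∣g₀∣≤c = subst (∣ g₀ ∣ ≤_) (cong ∣_∣ g₀h₀≡b) (∣i∣≤∣i*j∣ g₀ h₀ h₀≢0)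
    ∣h₀∣≤c : ∣ h₀ ∣ ≤ c
    ∣h₀∣≤c = subst (∣ h₀ ∣ ≤_) (cong ∣_∣ (trans (ℤP.*-comm h₀ g₀) g₀h₀≡b)) (∣i∣≤∣i*j∣ h₀ g₀ g₀≢0)
    h≢0 : ∀ j → j ≤ suc d′ → eval (monic (h₀ ∷ h′)) (+ (B + j)) ≢ 0ℤ
    h≢0 j _ = ∣c∣<k⇒c+k*t≢0 h₀ _ (B + j) h₀≢0 (s≤s (≤-trans ∣h₀∣≤c (m≤m+n c j)))
    deg-g≤n : suc d′ ≤ n
    deg-g≤n = s≤s (m≤n⇒m≤1+n d′≤n′)
    norm₁-g : norm₁ (monic (g₀ ∷ g′)) ≤ coefficientBound * H
    norm₁-g = begin
      norm₁ (monic (g₀ ∷ g′))           ≤⟨ norm₁-monicFactor≤ B M (fam n b a) (g₀ ∷ g′) (h₀ ∷ h′) f≡gh h≢0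
                                             (λ j j≤ → fam-value-bound {a} f≤H (≤-trans j≤ deg-g≤n)) ⟩
      interpolationConst (suc d′) B * M ≤⟨ *-monoˡ-≤ M (interpolationConst-mono B deg-g≤n) ⟩
      interpolationConst n B * M        ≡⟨ ring (interpolationConst n B) (suc n) H ((B + n) ^ suc n) ⟩
      coefficientBound * H              ∎
      where
      ring : ∀ k l h p → k * (l * h * p) ≡ k * (l * p) * h
      ring = ℕ-Solver.solve-∀
    g′-bounded : ∀ {x} → x ∈ toList g′ → x ∈ range (coefficientBound * H)
    g′-bounded {x} x∈g′ =
      ∣∣≤⇒∈range x (≤-trans (∈⇒∣∣≤norm₁ {p = monic (g₀ ∷ g′)} (there (∈-++⁺ˡ x∈g′))) norm₁-g)

  monicProduct : ∀ {d e} → Vec ℤ d → Vec ℤ e → List ℤ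
  monicProduct g h = polyMul (monic g) (monic h)

  splitProducts : ℕ → ℕ → List (List ℤ)
  splitProducts T d′ = cartesianProductWith monicProduct (box d′ T) (box (n′ ∸ d′) T)

  products : ℕ → ℕ → List (List ℤ)
  products T zero    = []
  products T (suc k) = splitProducts T k ++ products T k

  ∈-splitProducts⁺ : ∀ {T d′ e′} {g : Vec ℤ (suc d′)} {h : Vec ℤ (suc e′)} → d′ + e′ ≡ n′ →
                     g ∈ box d′ T → h ∈ box e′ T → monicProduct g h ∈ splitProducts T d′
  ∈-splitProducts⁺ {d′ = d′} {e′} d′+e′≡n′ g∈ h∈
    with refl ← trans (sym (m+n∸m≡n d′ e′)) (cong (_∸ d′) d′+e′≡n′) =
    ∈-cartesianProductWith⁺ monicProduct g∈ h∈

  ∈-products⁺ : ∀ {T d′ k f} → d′ < k → f ∈ splitProducts T d′ → f ∈ products T k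
  ∈-products⁺ {T} {d′} {f = f} d′<k f∈ = go (≤⇒≤′ d′<k)
    where
    go : ∀ {k} → suc d′ ≤′ k → f ∈ products T k
    go ≤′-refl                   = ∈-++⁺ˡ f∈
    go {suc k} (≤′-step d′<′k) = ∈-++⁺ʳ (splitProducts T k) (go d′<′k)

  ∈-products⇒ReducibleMonic : ∀ {T k f} → k ≤ suc n′ → f ∈ products T k → ReducibleMonic n f
  ∈-products⇒ReducibleMonic {T} {suc k} (s≤s k≤n′) f∈ with ∈-++⁻ (splitProducts T k) f∈
  ... | inj₂ f∈rest = ∈-products⇒ReducibleMonic (m≤n⇒m≤1+n k≤n′) f∈rest
  ... | inj₁ f∈split
    with g , h , _ , _ , refl ← ∈-cartesianProductWith⁻ monicProduct (box k T) (box (n′ ∸ k) T) f∈split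
    = suc k , suc (n′ ∸ k) , s≤s z≤n , s≤s z≤n ,
      cong suc (trans (+-suc k (n′ ∸ k)) (cong suc (m+[n∸m]≡n k≤n′))) , g , h , refl

  length-splitProducts : ∀ T d′ → d′ ≤ n′ →
    length (splitProducts T d′) ≡ (suc c + c) * (suc c + c) * (suc T + T) ^ n′
  length-splitProducts T d′ d′≤n′ = begin
    length (splitProducts T d′)                    ≡⟨ length-cartesianProductWith monicProduct (box d′ T) _ ⟩
    length (box d′ T) * length (box (n′ ∸ d′) T)   ≡⟨ cong₂ _*_ (length-box d′ T) (length-box (n′ ∸ d′) T) ⟩
    (s * R ^ d′) * (s * R ^ (n′ ∸ d′))             ≡⟨ ring s (R ^ d′) (R ^ (n′ ∸ d′)) ⟩
    s * s * (R ^ d′ * R ^ (n′ ∸ d′))               ≡⟨ cong (s * s *_) (^-distribˡ-+-* R d′ (n′ ∸ d′)) ⟨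
    s * s * R ^ (d′ + (n′ ∸ d′))                   ≡⟨ cong (λ k → s * s * R ^ k) (m+[n∸m]≡n d′≤n′) ⟩
    s * s * R ^ n′                                 ∎
    where
    open ≡-Reasoning
    s = suc c + c
    R = suc T + T
    ring : ∀ s a b → (s * a) * (s * b) ≡ s * s * (a * b)
    ring = ℕ-Solver.solve-∀

  length-products : ∀ T k → k ≤ suc n′ →
    length (products T k) ≤ k * ((suc c + c) * (suc c + c) * (suc T + T) ^ n′)
  length-products T zero    _          = z≤n
  length-products T (suc k) (s≤s k≤n′) = begin
    length (splitProducts T k ++ products T k)             ≡⟨ length-++ (splitProducts T k) ⟩
    length (splitProducts T k) + length (products T k)     ≤⟨ +-mono-≤ (≤-reflexive (length-splitProducts T k k≤n′))
                                                                       (length-products T k (m≤n⇒m≤1+n k≤n′)) ⟩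
    suc k * ((suc c + c) * (suc c + c) * (suc T + T) ^ n′) ∎
    where open ≤-Reasoning

  _≟ᵥ_ : DecidableEquality (Vec ℤ (suc n′))
  _≟ᵥ_ = Vec.≡-dec ℤ._≟_

  open import Data.List.Relation.Unary.Unique.DecPropositional.Properties _≟ᵥ_ using (deduplicate-!)

  -- A decidable stand-in for reducibility: by factor∈box, both factors of any
  -- factorisation of a polynomial of height ≤ H lie in the boxes.
  BoxFactorisable : ℕ → Vec ℤ (suc n′) → Set
  BoxFactorisable H a = fam n b a ∈ products (coefficientBound * H) (suc n′) × height (fam n b a) ≤ H

  boxFactorisable? : ∀ H → Decidable (BoxFactorisable H)
  boxFactorisable? H a =
    (fam n b a ∈? products (coefficientBound * H) (suc n′)) ×-dec (height (fam n b a) ≤? H)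

  boxFactorisables : ℕ → List (Vec ℤ (suc n′))
  boxFactorisables H = filter (boxFactorisable? H) (cube (suc n′) (range H))

  reducibles : ℕ → List (Vec ℤ (suc n′))
  reducibles H = deduplicate _≟ᵥ_ (boxFactorisables H)

  unique-reducibles : ∀ H → Unique (reducibles H)
  unique-reducibles H = deduplicate-! (boxFactorisables H)

  ∈-reducibles⁻ : ∀ {H a} → a ∈ reducibles H → BoxFactorisable H a
  ∈-reducibles⁻ {H} a∈ = proj₂ (∈-filter⁻ (boxFactorisable? H) {xs = cube (suc n′) (range H)}
    (∈-deduplicate⁻ _≟ᵥ_ (boxFactorisables H) a∈))

  reducible⇒∈products : ∀ {a H} → ReducibleMonic n (fam n b a) → height (fam n b a) ≤ H →
                        fam n b a ∈ products (coefficientBound * H) (suc n′)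
  reducible⇒∈products (zero , _ , () , _)
  reducible⇒∈products (suc d′ , zero , _ , () , _)
  reducible⇒∈products {a} {H} (suc d′ , suc e′ , _ , _ , d+e≡n , g₀ ∷ g′ , h₀ ∷ h′ , gh≡f) f≤H =
    subst (_∈ products T (suc n′)) gh≡f (∈-products⁺ {T} (s≤s d′≤n′) (∈-splitProducts⁺ {T} d′+e′≡n′
      (factor∈box {a = a} g h d′≤n′ f≡gh g₀h₀≡b f≤H)
      (factor∈box {a = a} h g e′≤n′ f≡hg (trans (ℤP.*-comm h₀ g₀) g₀h₀≡b) f≤H)))
    where
    T = coefficientBound * H
    g = g₀ ∷ g′
    h = h₀ ∷ h′
    d′+e′≡n′ : d′ + e′ ≡ n′
    d′+e′≡n′ = suc-injective (trans (sym (+-suc d′ e′)) (suc-injective d+e≡n))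
    d′≤n′ : d′ ≤ n′
    d′≤n′ = ≤-trans (m≤m+n d′ e′) (≤-reflexive d′+e′≡n′)
    e′≤n′ : e′ ≤ n′
    e′≤n′ = ≤-trans (m≤n+m e′ d′) (≤-reflexive d′+e′≡n′)
    f≡gh : ∀ x → eval (fam n b a) x ≡ eval (monic g) x ℤ.* eval (monic h) x
    f≡gh x = trans (cong (λ p → eval p x) (sym gh≡f)) (eval-polyMul (monic g) (monic h) x)
    f≡hg : ∀ x → eval (fam n b a) x ≡ eval (monic h) x ℤ.* eval (monic g) x
    f≡hg x = trans (f≡gh x) (ℤP.*-comm (eval (monic g) x) (eval (monic h) x))
    g₀h₀≡b : g₀ ℤ.* h₀ ≡ b
    g₀h₀≡b = trans (sym (ℤP.+-identityʳ (g₀ ℤ.* h₀))) (List.∷-injectiveˡ gh≡f)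

  ∈-reducibles⇔ : ∀ H a → a ∈ reducibles H ⇔ (ReducibleMonic n (fam n b a) × height (fam n b a) ≤ H)
  ∈-reducibles⇔ H a = mk⇔
    (λ a∈ → let f∈ , f≤H = ∈-reducibles⁻ a∈ in ∈-products⇒ReducibleMonic ≤-refl f∈ , f≤H)
    (λ (red , f≤H) → ∈-deduplicate⁺ _≟ᵥ_ (∈-filter⁺ (boxFactorisable? H)
      (∈-cube⁺ a (All.tabulate (coefficient∈range f≤H))) (reducible⇒∈products red f≤H , f≤H)))
    where
    coefficient∈range : height (fam n b a) ≤ H → ∀ {x} → x ∈ toList a → x ∈ range H
    coefficient∈range f≤H {x} x∈a =
      ∣∣≤⇒∈range x (≤-trans (∈⇒∣∣≤height {p = fam n b a} (there (∈-++⁺ˡ x∈a))) f≤H)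

  upperConst : ℕ
  upperConst = suc n′ * ((suc c + c) * (suc c + c) * suc (2 * coefficientBound) ^ n′)

  length-reducibles≤ : ∀ H → 1 ≤ H → length (reducibles H) ≤ upperConst * H ^ n′
  length-reducibles≤ H 1≤H = begin
    length (reducibles H)                 ≡⟨ length-map (fam n b) (reducibles H) ⟨
    length (map (fam n b) (reducibles H)) ≤⟨ Unique∧⊆⇒length≤ (Unique.map⁺ fam-injective (unique-reducibles H))
                                                               fam-reducibles⊆products ⟩
    length (products T (suc n′))          ≤⟨ length-products T (suc n′) ≤-refl ⟩
    suc n′ * (s * s * (suc T + T) ^ n′)   ≤⟨ *-monoʳ-≤ (suc n′) (*-monoʳ-≤ (s * s) (^-monoˡ-≤ n′ 1+2T≤K*H)) ⟩
    suc n′ * (s * s * (K * H) ^ n′)       ≡⟨ cong (λ x → suc n′ * (s * s * x)) (^-distribʳ-* K H n′) ⟩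
    suc n′ * (s * s * (K ^ n′ * H ^ n′))  ≡⟨ ring (suc n′) (s * s) (K ^ n′) (H ^ n′) ⟩
    upperConst * H ^ n′                   ∎
    where
    open ≤-Reasoning
    T = coefficientBound * H
    s = suc c + c
    K = suc (2 * coefficientBound)
    fam-reducibles⊆products : map (fam n b) (reducibles H) ⊆ products T (suc n′)
    fam-reducibles⊆products f∈ with a , a∈ , refl ← ∈-map⁻ (fam n b) f∈ = proj₁ (∈-reducibles⁻ a∈)
    double : ∀ k h → k * h + k * h ≡ 2 * k * h
    double = ℕ-Solver.solve-∀
    1+2T≤K*H : suc T + T ≤ K * H
    1+2T≤K*H = +-mono-≤ 1≤H (≤-reflexive (double coefficientBound H))
    ring : ∀ m q x y → m * (q * (x * y)) ≡ m * (q * x) * y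
    ring = ℕ-Solver.solve-∀

  lowerFamily : ℕ → List (Vec ℤ (suc n′))
  lowerFamily t = map (timesOnePlusX b) (cube n′ (map +_ (upTo (suc t))))

  length-lowerFamily : ∀ t → length (lowerFamily t) ≡ suc t ^ n′
  length-lowerFamily t = trans (length-map (timesOnePlusX b) (cube n′ R)) (trans (length-cube n′ R)
    (cong (_^ n′) (trans (length-map +_ (upTo (suc t))) (length-upTo (suc t)))))
    where R = map +_ (upTo (suc t))

  unique-lowerFamily : ∀ t → Unique (lowerFamily t)
  unique-lowerFamily t = Unique.map⁺ (timesOnePlusX-injective b)
    (cube⁺ n′ (Unique.map⁺ ℤP.+-injective (Unique.upTo⁺ (suc t))))

  lowerFamily⊆reducibles : ∀ {t H} → 2 * (c + suc t) ≤ H → lowerFamily t ⊆ reducibles H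
  lowerFamily⊆reducibles {t} {H} 2[c+t+1]≤H v∈ with cv , cv∈ , refl ← ∈-map⁻ (timesOnePlusX b) v∈ =
    Equivalence.from (∈-reducibles⇔ H (timesOnePlusX b cv)) (reducible , height≤H)
    where
    Q = b ∷ monic cv
    reducible : ReducibleMonic n (fam n b (timesOnePlusX b cv))
    reducible = 1 , suc n′ , s≤s z≤n , s≤s z≤n , refl , (+ 1 ∷ []) , (b ∷ cv) , polyMul-onePlusX b cv
    small : ∀ {x} → x ∈ map +_ (upTo (suc t)) → ∣ x ∣ ≤ c + suc t
    small x∈ with i , i∈ , refl ← ∈-map⁻ +_ x∈ = ≤-trans (<⇒≤ (∈-upTo⁻ i∈)) (m≤n+m (suc t) c)
    height-Q : height Q ≤ c + suc t
    height-Q = All⇒height≤ {p = Q} (m≤m+n c (suc t) ∷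
      ++⁺ (All.map small (∈-cube⁻ cv cv∈)) (≤-trans (s≤s z≤n) (m≤n+m (suc t) c) ∷ []))
    height≤H : height (fam n b (timesOnePlusX b cv)) ≤ H
    height≤H = subst (λ p → height p ≤ H) (polyMul-onePlusX b cv)
      (≤-trans (height-polyMul (+ 1 ∷ + 1 ∷ []) Q) (≤-trans (*-monoʳ-≤ 2 height-Q) 2[c+t+1]≤H))

  lowerConst : ℕ
  lowerConst = 4 + 2 * c

  H^n′≤lowerConst^n′*length-reducibles : ∀ H → lowerConst ≤ H →
                                         H ^ n′ ≤ lowerConst ^ n′ * length (reducibles H)
  H^n′≤lowerConst^n′*length-reducibles H W≤H = begin
    H ^ n′                          ≤⟨ ^-monoˡ-≤ n′ (<⇒≤ H<[t+1]*W) ⟩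
    (suc t * W) ^ n′                ≡⟨ ^-distribʳ-* (suc t) W n′ ⟩
    suc t ^ n′ * W ^ n′             ≡⟨ *-comm (suc t ^ n′) (W ^ n′) ⟩
    W ^ n′ * suc t ^ n′             ≡⟨ cong (W ^ n′ *_) (length-lowerFamily t) ⟨
    W ^ n′ * length (lowerFamily t) ≤⟨ *-monoʳ-≤ (W ^ n′) (Unique∧⊆⇒length≤ (unique-lowerFamily t)
                                                             (lowerFamily⊆reducibles 2[c+t+1]≤H)) ⟩
    W ^ n′ * length (reducibles H)  ∎
    where
    open ≤-Reasoning
    W = lowerConst
    t = H / W
    H<[t+1]*W : H < suc t * W
    H<[t+1]*W = begin-strict
      H             ≡⟨ m≡m%n+[m/n]*n H W ⟩
      H % W + t * W <⟨ +-monoˡ-< (t * W) (m%n<n H W) ⟩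
      W + t * W     ∎
    2[c+u+1]≤u*W : ∀ u → 1 ≤ u → 2 * (c + suc u) ≤ u * W
    2[c+u+1]≤u*W (suc u) _ =
      ≤-trans (m≤m+n (2 * (c + suc (suc u))) (2 * u + 2 * c * u)) (≤-reflexive (ring c u))
      where
      ring : ∀ c u → 2 * (c + suc (suc u)) + (2 * u + 2 * c * u) ≡ suc u * (4 + 2 * c)
      ring = ℕ-Solver.solve-∀
    2[c+t+1]≤H : 2 * (c + suc t) ≤ H
    2[c+t+1]≤H = ≤-trans (2[c+u+1]≤u*W t (m≥n⇒m/n>0 W≤H)) (m/n*n≤m H W)

lemma3p3 : (n : ℕ) → 2 ≤ n → (b : ℤ) → ¬ (b ≡ + 0) →
    Σ ℕ λ C → Σ ℕ λ H₀ → (H : ℕ) → H₀ ≤ H →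
      Σ (List (Vec ℤ (n ∸ 1))) λ L →
        Unique L ×
        ((a : Vec ℤ (n ∸ 1)) →
          (a ∈ L) ⇔ (ReducibleMonic n (fam n b a) × height (fam n b a) ≤ H)) ×
        length L ≤ C * H ^ (n ∸ 2) ×
        H ^ (n ∸ 2) ≤ C * length L
lemma3p3 (suc zero)     (s≤s ()) b b≢0
lemma3p3 (suc (suc n′)) _        b b≢0 =
  upperConst + lowerConst ^ n′ , lowerConst , λ H W≤H →
    reducibles H , unique-reducibles H , ∈-reducibles⇔ H ,
    ≤-trans (length-reducibles≤ H (≤-trans (s≤s z≤n) W≤H)) (*-monoˡ-≤ (H ^ n′) (m≤m+n upperConst _)) ,
    ≤-trans (H^n′≤lowerConst^n′*length-reducibles H W≤H)
            (*-monoˡ-≤ (length (reducibles H)) (m≤n+m _ upperConst))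
  where open Counting n′ b b≢0
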